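{- Let $G_1,G_2$ be graphs with $V(G_1)\cap V(G_2)=\{w\}$. Then $G_1\cup G_2$ is canceling if and only if both $G_1$ and $G_2$ are canceling.
   Context: A signing of a graph $G$ is a map $\sigma:E(G)\to\{\pm1\}$; for a path $P$, $\sigma(P)=\sum_{e\in P}\sigma(e)$; $d_\sigma(u,v)=\min_P|\sigma(P)|$ over all $uv$-paths $P$ in $G$ ($\infty$ if none exists, $0$ if $u=v$); $W_\sigma(G)=\frac12\sum_{u,v\in V(G)}d_\sigma(u,v)$. $G$ is canceling if some signing $\sigma$ has $W_\sigma(G)=0$. -}

module Defs where

open import Data.Nat using (ℕ)
open import Data.Integer using (ℤ; +_; -[1+_]; _+_)
open import Data.Bool using (Bool; true; false; _∨_)
open import Data.Bool.Properties using (∨-comm)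
open import Data.List using (List; []; _∷_; _++_; head; last)
open import Data.List.Membership.Propositional using (_∈_)
open import Data.List.Membership.Propositional.Properties using (∈-++⁺ˡ; ∈-++⁺ʳ)
open import Data.List.Relation.Unary.Unique.Propositional using (Unique)
open import Data.List.Relation.Unary.All using (All)
open import Data.Maybe using (Maybe; just)
open import Data.Product using (_×_; _,_; Σ; ∃)
open import Data.Sum using (_⊎_; inj₁; inj₂)
open import Relation.Binary.PropositionalEquality using (_≡_; refl; cong₂)

-- V lists the vertex set (repetitions are harmless: only membership is used),
-- adj is the (symmetric, loopless) adjacency relation, supported on V.
record Graph : Set where
  field
    V     : List ℕ
    adj   : ℕ → ℕ → Bool
    sym   : ∀ u v → adj u v ≡ adj v u
    loopless : ∀ u → adj u u ≡ false
    closed : ∀ u v → adj u v ≡ true → (u ∈ V) × (v ∈ V)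
open Graph public

private
  ∨-false : ∀ {a b} → a ≡ false → b ≡ false → (a ∨ b) ≡ false
  ∨-false refl refl = refl

  ∨-true : ∀ a b → (a ∨ b) ≡ true → (a ≡ true) ⊎ (b ≡ true)
  ∨-true true b _ = inj₁ refl
  ∨-true false b p = inj₂ p

_∪ᴳ_ : Graph → Graph → Graph
G₁ ∪ᴳ G₂ = record
  { V = V G₁ ++ V G₂
  ; adj = λ u v → adj G₁ u v ∨ adj G₂ u v
  ; sym = λ u v → cong₂ _∨_ (sym G₁ u v) (sym G₂ u v)
  ; loopless = λ u → ∨-false (loopless G₁ u) (loopless G₂ u)
  ; closed = λ u v p → cl u v (∨-true _ _ p)
  }
  where
  cl : ∀ u v → (adj G₁ u v ≡ true) ⊎ (adj G₂ u v ≡ true)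
     → (u ∈ V G₁ ++ V G₂) × (v ∈ V G₁ ++ V G₂)
  cl u v (inj₁ p) with closed G₁ u v p
  ... | a , b = ∈-++⁺ˡ a , ∈-++⁺ˡ b
  cl u v (inj₂ p) with closed G₂ u v p
  ... | a , b = ∈-++⁺ʳ (V G₁) a , ∈-++⁺ʳ (V G₁) b

data Sign : Set where
  plus minus : Sign

⟦_⟧ : Sign → ℤ
⟦ plus ⟧  = + 1
⟦ minus ⟧ = -[1+ 0 ]

-- A signing of G: a map E(G) → {±1}; an edge {u,v} gets σ u v = σ v u.
-- Values on non-edges are irrelevant.
record Signing (G : Graph) : Set where
  field
    σ : ℕ → ℕ → Sign
    σ-sym : ∀ u v → adj G u v ≡ true → σ u v ≡ σ v u
open Signing public

Walk : Graph → List ℕ → Set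
Walk G [] = ⊤'
  where open import Data.Unit using () renaming (⊤ to ⊤')
Walk G (x ∷ []) = x ∈ V G
Walk G (x ∷ y ∷ xs) = (adj G x y ≡ true) × Walk G (y ∷ xs)

IsPath : (G : Graph) → ℕ → ℕ → List ℕ → Set
IsPath G u v P = Walk G P × Unique P × (head P ≡ just u) × (last P ≡ just v)

σsum : (ℕ → ℕ → Sign) → List ℕ → ℤ
σsum s [] = + 0
σsum s (x ∷ []) = + 0
σsum s (x ∷ y ∷ xs) = ⟦ s x y ⟧ + σsum s (y ∷ xs)

-- d_σ(u,v) = 0 : some u-v path P has σ(P) = 0 (min over paths of |σ(P)| is 0)
DistZero : (G : Graph) → Signing G → ℕ → ℕ → Set
DistZero G s u v = Σ (List ℕ) λ P → IsPath G u v P × (σsum (σ s) P ≡ + 0)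

-- W_σ(G) = 0 : every term d_σ(u,v) (each ≥ 0, or ∞) of the sum vanishes
WienerZero : (G : Graph) → Signing G → Set
WienerZero G s = ∀ u v → u ∈ V G → v ∈ V G → DistZero G s u v

Canceling : Graph → Set
Canceling G = Σ (Signing G) λ s → WienerZero G s

-- A path of G₁ ∪ G₂ between two vertices of G₁ never uses an edge of G₂: once it
-- leaves G₁ it sits in G₂, and can only come back through the cut vertex w, which it
-- already visited. So a canceling signing of the union restricts to one of each part.
-- Conversely, signing each edge as in its own part makes a pair of vertices on
-- opposite sides cancel along a zero path to w followed by a zero path from w.
module Submission where

open import Defs
open import Data.Nat using (ℕ)
open import Data.Bool using (true; false; _∨_; if_then_else_)
open import Data.Bool.Properties using (∨-zeroʳ)
open import Data.Empty using (⊥; ⊥-elim)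
open import Data.Integer using (+_; _+_)
open import Data.Integer.Properties using (+-assoc; +-identityˡ)
open import Data.List using ([]; _∷_; _++_; head; last)
open import Data.List.Membership.Propositional using (_∈_)
open import Data.List.Membership.Propositional.Properties using (∈-++⁺ˡ; ∈-++⁺ʳ; ∈-++⁻)
open import Data.List.Relation.Unary.All as All using (All; []; _∷_)
open import Data.List.Relation.Unary.AllPairs using (_∷_)
open import Data.List.Relation.Unary.Any using (here; there)
open import Data.List.Relation.Unary.Unique.Propositional using (Unique)
import Data.List.Relation.Unary.Unique.Propositional.Properties as Unique
open import Data.Maybe using (just)
open import Data.Maybe.Properties using (just-injective)
open import Data.Product using (_×_; _,_; proj₁; proj₂)
open import Data.Sum using (_⊎_; inj₁; inj₂) renaming (swap to ⊎-swap)
open import Function.Bundles using (_⇔_; mk⇔)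
open import Relation.Binary.PropositionalEquality
  using (_≡_; refl; trans; cong; cong₂; module ≡-Reasoning) renaming (sym to ≡-sym)
open ≡-Reasoning

record _⊆ᴳ_ (A U : Graph) : Set where
  field
    edge⊆ : ∀ {x y} → adj A x y ≡ true → adj U x y ≡ true
    vert⊆ : ∀ {x} → x ∈ V A → x ∈ V U
open _⊆ᴳ_

record GluedAt (U A B : Graph) (w : ℕ) : Set where
  field
    left⊆      : A ⊆ᴳ U
    right⊆     : B ⊆ᴳ U
    edge-split : ∀ {x y} → adj U x y ≡ true → adj A x y ≡ true ⊎ adj B x y ≡ true
    vert-split : ∀ {x} → x ∈ V U → x ∈ V A ⊎ x ∈ V B
    meet       : ∀ {x} → x ∈ V A → x ∈ V B → x ≡ w
open GluedAt

swap : ∀ {U A B w} → GluedAt U A B w → GluedAt U B A w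
swap g = record
  { left⊆ = right⊆ g
  ; right⊆ = left⊆ g
  ; edge-split = λ e → ⊎-swap (edge-split g e)
  ; vert-split = λ x → ⊎-swap (vert-split g x)
  ; meet = λ xB xA → meet g xA xB
  }

∪ᴳ-gluedAt : ∀ G₁ G₂ {w} → (∀ x → x ∈ V G₁ → x ∈ V G₂ → x ≡ w) → GluedAt (G₁ ∪ᴳ G₂) G₁ G₂ w
∪ᴳ-gluedAt G₁ G₂ disjoint = record
  { left⊆ = record { edge⊆ = λ e → cong (_∨ _) e ; vert⊆ = ∈-++⁺ˡ }
  ; right⊆ = record
      { edge⊆ = λ {x y} e → trans (cong (adj G₁ x y ∨_) e) (∨-zeroʳ (adj G₁ x y))
      ; vert⊆ = ∈-++⁺ʳ (V G₁) }
  ; edge-split = split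
  ; vert-split = ∈-++⁻ (V G₁)
  ; meet = disjoint _
  }
  where
  split : ∀ {x y} → adj G₁ x y ∨ adj G₂ x y ≡ true → adj G₁ x y ≡ true ⊎ adj G₂ x y ≡ true
  split {x} {y} e with adj G₁ x y
  ... | true  = inj₁ refl
  ... | false = inj₂ e

Walk-mono : ∀ {A U} → A ⊆ᴳ U → ∀ P → Walk A P → Walk U P
Walk-mono i []           _        = _
Walk-mono i (x ∷ [])     x∈       = vert⊆ i x∈
Walk-mono i (x ∷ y ∷ xs) (e , wk) = edge⊆ i e , Walk-mono i (y ∷ xs) wk

Walk⇒All∈V : ∀ G P → Walk G P → All (_∈ V G) P
Walk⇒All∈V G []           _        = []
Walk⇒All∈V G (x ∷ [])     x∈       = x∈ ∷ []
Walk⇒All∈V G (x ∷ y ∷ xs) (e , wk) = proj₁ (closed G x y e) ∷ Walk⇒All∈V G (y ∷ xs) wk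

Walk-++ : ∀ {G} {w : ℕ} P Q → Walk G P → last P ≡ just w → Walk G (w ∷ Q) → Walk G (P ++ Q)
Walk-++ (x ∷ [])     Q _        refl wq = wq
Walk-++ (x ∷ y ∷ xs) Q (e , wp) l    wq = e , Walk-++ (y ∷ xs) Q wp l wq

last-++ : ∀ {w : ℕ} P Q → last P ≡ just w → last (P ++ Q) ≡ last (w ∷ Q)
last-++ (x ∷ [])     Q refl = refl
last-++ (x ∷ y ∷ xs) Q l    = last-++ (y ∷ xs) Q l

IsPath-mono : ∀ {A U u v P} → A ⊆ᴳ U → IsPath A u v P → IsPath U u v P
IsPath-mono {P = P} i (wk , uq , hd , l) = Walk-mono i P wk , uq , hd , l

IsPath-join : ∀ {U A B w u v P Q} → GluedAt U A B w
  → IsPath A u w P → IsPath B w v (w ∷ Q) → IsPath U u v (P ++ Q)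
IsPath-join {A = A} {B} {P = P} {Q} g (wP , uP , hd , lP) (wQ , w∉Q ∷ uQ , _ , lQ) =
  Walk-++ P Q (Walk-mono (left⊆ g) P wP) lP (Walk-mono (right⊆ g) (_ ∷ Q) wQ)
  , Unique.++⁺ uP uQ disjoint
  , head-++ P hd
  , trans (last-++ P Q lP) lQ
  where
  head-++ : ∀ {u} P → head P ≡ just u → head (P ++ Q) ≡ just u
  head-++ (x ∷ _) hd = hd
  disjoint : ∀ {z} → z ∈ P × z ∈ Q → ⊥
  disjoint (z∈P , z∈Q) with meet g (All.lookup (Walk⇒All∈V A P wP) z∈P)
                                   (All.lookup (Walk⇒All∈V B (_ ∷ Q) wQ) (there z∈Q))
  ... | refl = All.lookup w∉Q z∈Q refl

σsum-++ : ∀ s {w} P Q → last P ≡ just w → σsum s (P ++ Q) ≡ σsum s P + σsum s (w ∷ Q)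
σsum-++ s (x ∷ [])     Q refl = ≡-sym (+-identityˡ _)
σsum-++ s (x ∷ y ∷ xs) Q l    = begin
  ⟦ s x y ⟧ + σsum s ((y ∷ xs) ++ Q)              ≡⟨ cong (λ r → ⟦ s x y ⟧ + r) (σsum-++ s (y ∷ xs) Q l) ⟩
  ⟦ s x y ⟧ + (σsum s (y ∷ xs) + σsum s (_ ∷ Q))  ≡⟨ ≡-sym (+-assoc ⟦ s x y ⟧ _ _) ⟩
  ⟦ s x y ⟧ + σsum s (y ∷ xs) + σsum s (_ ∷ Q)    ∎

AgreeOn : Graph → (ℕ → ℕ → Sign) → (ℕ → ℕ → Sign) → Set
AgreeOn A s t = ∀ {x y} → adj A x y ≡ true → s x y ≡ t x y

σsum-cong : ∀ {A s t} → AgreeOn A s t → ∀ P → Walk A P → σsum s P ≡ σsum t P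
σsum-cong agree []           _        = refl
σsum-cong agree (x ∷ [])     _        = refl
σsum-cong agree (x ∷ y ∷ xs) (e , wk) =
  cong₂ (λ a r → ⟦ a ⟧ + r) (agree e) (σsum-cong agree (y ∷ xs) wk)

DistZero-mono : ∀ {A U} {sA : Signing A} {sU : Signing U} {u v} → A ⊆ᴳ U
  → AgreeOn A (σ sU) (σ sA) → DistZero A sA u v → DistZero U sU u v
DistZero-mono i agree (P , path , zero) =
  P , IsPath-mono i path , trans (σsum-cong agree P (proj₁ path)) zero

DistZero-join : ∀ {U A B w} {sA : Signing A} {sB : Signing B} {S : Signing U} {u v}
  → GluedAt U A B w → AgreeOn A (σ S) (σ sA) → AgreeOn B (σ S) (σ sB)
  → DistZero A sA u w → DistZero B sB w v → DistZero U S u v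
DistZero-join {sA = sA} {sB} {S} g agreeA agreeB
  (P , pathP , zeroP) (w ∷ Q , pathQ@(_ , _ , refl , _) , zeroQ) =
  P ++ Q , IsPath-join g pathP pathQ , (begin
    σsum (σ S) (P ++ Q)                  ≡⟨ σsum-++ (σ S) P Q (proj₂ (proj₂ (proj₂ pathP))) ⟩
    σsum (σ S) P + σsum (σ S) (w ∷ Q)    ≡⟨ cong₂ _+_ (σsum-cong agreeA P (proj₁ pathP))
                                                     (σsum-cong agreeB (w ∷ Q) (proj₁ pathQ)) ⟩
    σsum (σ sA) P + σsum (σ sB) (w ∷ Q)  ≡⟨ cong₂ _+_ zeroP zeroQ ⟩
    + 0                                  ∎)

module _ {U A B w} (g : GluedAt U A B w) where

  walk-from-B-to-A-visits-w : ∀ y R {v} → Walk U (y ∷ R) → y ∈ V B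
    → last (y ∷ R) ≡ just v → v ∈ V A → w ∈ y ∷ R
  walk-from-B-to-A-visits-w y [] _ yB l vA with just-injective l
  ... | refl = here (≡-sym (meet g vA yB))
  walk-from-B-to-A-visits-w y (z ∷ R) (e , wk) yB l vA with edge-split g e
  ... | inj₁ eA = here (≡-sym (meet g (proj₁ (closed A y z eA)) yB))
  ... | inj₂ eB = there (walk-from-B-to-A-visits-w z R wk (proj₂ (closed B y z eB)) l vA)

  path-between-A-stays-in-A : ∀ x R {v} → Walk U (x ∷ R) → x ∈ V A → Unique (x ∷ R)
    → last (x ∷ R) ≡ just v → v ∈ V A → Walk A (x ∷ R)
  path-between-A-stays-in-A x []      _        xA _            _ _  = xA
  path-between-A-stays-in-A x (y ∷ R) (e , wk) xA (x∉R ∷ uR) l vA with edge-split g e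
  ... | inj₁ eA = eA , path-between-A-stays-in-A y R wk (proj₂ (closed A x y eA)) uR l vA
  ... | inj₂ eB with meet g xA (proj₁ (closed B x y eB))
  ...   | refl = ⊥-elim (All.lookup x∉R
                   (walk-from-B-to-A-visits-w y R wk (proj₂ (closed B x y eB)) l vA) refl)

  restrict : Canceling U → Canceling A
  restrict (s , zero) = sA , zeroA
    where
    sA : Signing A
    sA = record { σ = σ s ; σ-sym = λ u v e → σ-sym s u v (edge⊆ (left⊆ g) e) }
    zeroA : WienerZero A sA
    zeroA u v uA vA with zero u v (vert⊆ (left⊆ g) uA) (vert⊆ (left⊆ g) vA)
    ... | x ∷ R , (wk , uq , refl , l) , z =
      x ∷ R , (path-between-A-stays-in-A x R wk uA uq l vA , uq , refl , l) , z

module _ {U A B w} (g : GluedAt U A B w) where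

  B-edge⇒¬A-edge : ∀ {x y} → adj B x y ≡ true → adj A x y ≡ false
  B-edge⇒¬A-edge {x} {y} eB with adj A x y in eA
  ... | false = refl
  ... | true with meet g (proj₁ (closed A x y eA)) (proj₁ (closed B x y eB))
                | meet g (proj₂ (closed A x y eA)) (proj₂ (closed B x y eB))
  ...   | refl | refl = trans (≡-sym eA) (loopless A w)

  glueSigning : Signing A → Signing B → Signing U
  glueSigning sA sB = record { σ = τ ; σ-sym = τ-sym }
    where
    τ : ℕ → ℕ → Sign
    τ x y = if adj A x y then σ sA x y else σ sB x y
    τ-sym : ∀ x y → adj U x y ≡ true → τ x y ≡ τ y x
    τ-sym x y e rewrite Graph.sym A y x with adj A x y in eA | edge-split g e
    ... | true  | _       = σ-sym sA x y eA
    ... | false | inj₂ eB = σ-sym sB x y eB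
    ... | false | inj₁ ()

  glueSigning-agreeˡ : ∀ sA sB → AgreeOn A (σ (glueSigning sA sB)) (σ sA)
  glueSigning-agreeˡ sA sB eA rewrite eA = refl

  glueSigning-agreeʳ : ∀ sA sB → AgreeOn B (σ (glueSigning sA sB)) (σ sB)
  glueSigning-agreeʳ sA sB eB rewrite B-edge⇒¬A-edge eB = refl

  glue : w ∈ V A → w ∈ V B → Canceling A → Canceling B → Canceling U
  glue wA wB (sA , zeroA) (sB , zeroB) = S , zeroS
    where
    S : Signing U
    S = glueSigning sA sB
    agreeA : AgreeOn A (σ S) (σ sA)
    agreeA = glueSigning-agreeˡ sA sB
    agreeB : AgreeOn B (σ S) (σ sB)
    agreeB = glueSigning-agreeʳ sA sB
    zeroS : WienerZero U S
    zeroS u v uU vU with vert-split g uU | vert-split g vU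
    ... | inj₁ uA | inj₁ vA = DistZero-mono {sA = sA} {S} (left⊆ g) agreeA (zeroA u v uA vA)
    ... | inj₂ uB | inj₂ vB = DistZero-mono {sA = sB} {S} (right⊆ g) agreeB (zeroB u v uB vB)
    ... | inj₁ uA | inj₂ vB = DistZero-join {sA = sA} {sB} {S} g agreeA agreeB
                                (zeroA u w uA wA) (zeroB w v wB vB)
    ... | inj₂ uB | inj₁ vA = DistZero-join {sA = sB} {sA} {S} (swap g) agreeB agreeA
                                (zeroB u w uB wB) (zeroA w v wA vA)

lemma3p4 : (G₁ G₂ : Graph) (w : ℕ)
    → w ∈ V G₁ → w ∈ V G₂
    → (∀ x → x ∈ V G₁ → x ∈ V G₂ → x ≡ w)
    → Canceling (G₁ ∪ᴳ G₂) ⇔ (Canceling G₁ × Canceling G₂)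
lemma3p4 G₁ G₂ w w∈G₁ w∈G₂ disjoint =
  mk⇔ (λ c → restrict g c , restrict (swap g) c)
      (λ (c₁ , c₂) → glue g w∈G₁ w∈G₂ c₁ c₂)
  where
  g : GluedAt (G₁ ∪ᴳ G₂) G₁ G₂ w
  g = ∪ᴳ-gluedAt G₁ G₂ disjoint
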